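{- For every word $x$ and every system $S$ with $x\in S$, there exists a word $x_1$ which is a minimal prefix of $x$ in $S$, i.e. $x_1\in S$ and for every $y\in S$, if $y$ is a prefix of $x$ then $x_1$ is a prefix of $y$.
   Context: Work in a two-sorted first-order theory with equality whose sorts are words (lower-case variables) and systems (upper-case variables), with two word constants $0$ and $1$, a binary concatenation operation on words written by juxtaposition, and a membership relation $x\in S$ between a word and a system. Axioms: (symbols) $0\neq 1$ and $xy\neq 0$, $xy\neq 1$ for all words $x,y$; (associativity) $(xy)z=x(yz)$; (reading) $x0\neq y1$ for all $x,y$; (simplification) if $x_1y_1=x_2y_2$ and $y_1=y_2$ then $x_1=x_2$; (extensionality) two systems with the same elements are equal; (word induction) every system containing $0$ and $1$ and containing $x0$ and $x1$ whenever it contains $x$ contains every word; (comprehension) for every formula $\phi(x,x_1,\dots,x_n,S_1,\dots,S_m)$ in which $S$ is not free, there is a system $S$ with $x\in S\Leftrightarrow\phi$ for all words $x$. A word $x$ is a prefix of a word $y$ if $y=x$ or there is a word $z$ with $y=xz$. -}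

module Defs where

open import Data.Nat using (ℕ; suc)
open import Data.Fin using (Fin; zero; suc)
open import Data.Product using (Σ; _×_; _,_)
open import Data.Sum using (_⊎_)
open import Data.Empty using (⊥)
open import Relation.Binary.PropositionalEquality using (_≡_; _≢_)

-- Syntax of the two-sorted first-order language.
-- A formula of type  Formula n m  has word variables  Fin n  and
-- system variables  Fin m  (de Bruijn; binders add index 0).

data Term (n : ℕ) : Set where
  var  : Fin n → Term n
  `0   : Term n
  `1   : Term n
  _`·_ : Term n → Term n → Term n

data Formula (n m : ℕ) : Set where
  `⊥      : Formula n m
  _`≡_    : Term n → Term n → Formula n m
  _`∈_    : Term n → Fin m → Formula n m
  _`≡ˢ_   : Fin m → Fin m → Formula n m
  _`∧_    : Formula n m → Formula n m → Formula n m
  _`∨_    : Formula n m → Formula n m → Formula n m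
  _`⇒_    : Formula n m → Formula n m → Formula n m
  `∀w `∃w : Formula (suc n) m → Formula n m
  `∀S `∃S : Formula n (suc m) → Formula n m

record Structure : Set₁ where
  field
    Word   : Set
    System : Set
    𝟘 𝟙    : Word
    _·_    : Word → Word → Word
    _∈_    : Word → System → Set

module _ (M : Structure) where
  open Structure M

  extend : ∀ {n} {A : Set} → A → (Fin n → A) → Fin (suc n) → A
  extend a ρ zero    = a
  extend a ρ (suc i) = ρ i

  ⟦_⟧t : ∀ {n} → Term n → (Fin n → Word) → Word
  ⟦ var i  ⟧t ρ = ρ i
  ⟦ `0     ⟧t ρ = 𝟘
  ⟦ `1     ⟧t ρ = 𝟙
  ⟦ s `· t ⟧t ρ = ⟦ s ⟧t ρ · ⟦ t ⟧t ρ

  Sat : ∀ {n m} → Formula n m → (Fin n → Word) → (Fin m → System) → Set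
  Sat `⊥        ρ σ = ⊥
  Sat (s `≡ t)  ρ σ = ⟦ s ⟧t ρ ≡ ⟦ t ⟧t ρ
  Sat (t `∈ X)  ρ σ = ⟦ t ⟧t ρ ∈ σ X
  Sat (X `≡ˢ Y) ρ σ = σ X ≡ σ Y
  Sat (φ `∧ ψ)  ρ σ = Sat φ ρ σ × Sat ψ ρ σ
  Sat (φ `∨ ψ)  ρ σ = Sat φ ρ σ ⊎ Sat ψ ρ σ
  Sat (φ `⇒ ψ)  ρ σ = Sat φ ρ σ → Sat ψ ρ σ
  Sat (`∀w φ)   ρ σ = (w : Word) → Sat φ (extend w ρ) σ
  Sat (`∃w φ)   ρ σ = Σ Word λ w → Sat φ (extend w ρ) σ
  Sat (`∀S φ)   ρ σ = (S : System) → Sat φ ρ (extend S σ)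
  Sat (`∃S φ)   ρ σ = Σ System λ S → Sat φ ρ (extend S σ)

record IsWordModel (M : Structure) : Set₁ where
  open Structure M
  field
    0≢1            : 𝟘 ≢ 𝟙
    ·≢0            : ∀ x y → x · y ≢ 𝟘
    ·≢1            : ∀ x y → x · y ≢ 𝟙
    assoc          : ∀ x y z → (x · y) · z ≡ x · (y · z)
    reading        : ∀ x y → x · 𝟘 ≢ y · 𝟙
    simplification : ∀ x₁ y₁ x₂ y₂ → x₁ · y₁ ≡ x₂ · y₂ → y₁ ≡ y₂ → x₁ ≡ x₂
    extensionality : ∀ S T → (∀ x → (x ∈ S → x ∈ T) × (x ∈ T → x ∈ S)) → S ≡ T
    induction      : ∀ S → 𝟘 ∈ S → 𝟙 ∈ S
                       → (∀ x → x ∈ S → (x · 𝟘) ∈ S)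
                       → (∀ x → x ∈ S → (x · 𝟙) ∈ S)
                       → ∀ x → x ∈ S
    -- comprehension schema: φ has the word variable x (index 0) and
    -- parameters x₁..xₙ (ρ), S₁..Sₘ (σ); S is fresh (not among them).
    comprehension  : ∀ {n m} (φ : Formula (suc n) m)
                       (ρ : Fin n → Word) (σ : Fin m → System)
                     → Σ System λ S → ∀ x →
                         (x ∈ S → Sat M φ (extend M x ρ) σ)
                         × (Sat M φ (extend M x ρ) σ → x ∈ S)

IsPrefix : (M : Structure) → Structure.Word M → Structure.Word M → Set
IsPrefix M x y = (y ≡ x) ⊎ Σ (Structure.Word M) λ z → y ≡ Structure._·_ M x z

module Submission where

-- The proof is by word induction on x, applied through the comprehension
-- axiom to the definable property
--   P x :  every system S containing some prefix of x contains a prefix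
--          of x that is a prefix of every prefix of x lying in S.
-- The induction step uses excluded middle: if S contains a prefix of w,
-- the least one for w is also least for w·a; otherwise w·a is the only
-- prefix of w·a in S.

open import Defs
open import Data.Product using (Σ; _×_; _,_; proj₁; proj₂)
open import Data.Sum using (_⊎_; inj₁; inj₂)
open import Data.Empty using (⊥; ⊥-elim)
open import Data.Fin using (Fin; zero; suc)
open import Relation.Nullary using (yes; no)
open import Relation.Binary.PropositionalEquality using (_≡_; refl; sym; trans; subst)
open import Level using (0ℓ)
open import Axiom.ExcludedMiddle using (ExcludedMiddle)

module WordModel (M : Structure) (WM : IsWordModel M) where
  open Structure M
  open IsWordModel WM

  Letter : Word → Set
  Letter a = (a ≡ 𝟘) ⊎ (a ≡ 𝟙)

  Holds : Formula 1 0 → Word → Set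
  Holds φ x = Sat M φ (extend M x (λ ())) (λ ())

  definableInduction : (φ : Formula 1 0)
    → (∀ a → Letter a → Holds φ a)
    → (∀ w a → Letter a → Holds φ w → Holds φ (w · a))
    → ∀ x → Holds φ x
  definableInduction φ base step x =
    proj₁ (defines x)
      (induction S
        (proj₂ (defines 𝟘) (base 𝟘 (inj₁ refl)))
        (proj₂ (defines 𝟙) (base 𝟙 (inj₂ refl)))
        (λ w w∈S → proj₂ (defines (w · 𝟘)) (step w 𝟘 (inj₁ refl) (proj₁ (defines w) w∈S)))
        (λ w w∈S → proj₂ (defines (w · 𝟙)) (step w 𝟙 (inj₂ refl) (proj₁ (defines w) w∈S)))
        x)
    where
    S : System
    S = proj₁ (comprehension φ (λ ()) (λ ()))

    defines : ∀ x → (x ∈ S → Holds φ x) × (Holds φ x → x ∈ S)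
    defines = proj₂ (comprehension φ (λ ()) (λ ()))

  LetterOrSplit : Word → Set
  LetterOrSplit z = Letter z ⊎ Σ Word λ w → Σ Word λ a → Letter a × (z ≡ w · a)

  letterOrSplitF : Formula 1 0
  letterOrSplitF =
    ((var zero `≡ `0) `∨ (var zero `≡ `1)) `∨
    `∃w (`∃w (((var zero `≡ `0) `∨ (var zero `≡ `1))
              `∧ (var (suc (suc zero)) `≡ (var (suc zero) `· var zero))))

  letterOrSplit : ∀ z → LetterOrSplit z
  letterOrSplit = definableInduction letterOrSplitF
    (λ a a-letter → inj₁ a-letter)
    (λ w a a-letter _ → inj₂ (w , a , a-letter , refl))

  sameLastLetter : ∀ {x y b c} → Letter b → Letter c → x · b ≡ y · c → b ≡ c
  sameLastLetter         (inj₁ refl) (inj₁ refl) _ = refl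
  sameLastLetter         (inj₂ refl) (inj₂ refl) _ = refl
  sameLastLetter {x} {y} (inj₁ refl) (inj₂ refl) e = ⊥-elim (reading x y e)
  sameLastLetter {x} {y} (inj₂ refl) (inj₁ refl) e = ⊥-elim (reading y x (sym e))

  cancelLastLetter : ∀ {x y b c} → Letter b → Letter c → x · b ≡ y · c → x ≡ y
  cancelLastLetter b-letter c-letter e =
    simplification _ _ _ _ e (sameLastLetter b-letter c-letter e)

  Prefix : Word → Word → Set
  Prefix = IsPrefix M

  prefixExtend : ∀ {x w} a → Prefix x w → Prefix x (w · a)
  prefixExtend     a (inj₁ refl)       = inj₂ (a , refl)
  prefixExtend {x} a (inj₂ (z , refl)) = inj₂ (z · a , assoc x z a)

  prefixOfLetter : ∀ {u c} → Letter c → Prefix u c → u ≡ c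
  prefixOfLetter _           (inj₁ e)       = sym e
  prefixOfLetter (inj₁ refl) (inj₂ (_ , e)) = ⊥-elim (·≢0 _ _ (sym e))
  prefixOfLetter (inj₂ refl) (inj₂ (_ , e)) = ⊥-elim (·≢1 _ _ (sym e))

  prefixOfSnoc : ∀ {y w a} → Letter a → Prefix y (w · a) → (y ≡ w · a) ⊎ Prefix y w
  prefixOfSnoc _ (inj₁ e) = inj₁ (sym e)
  prefixOfSnoc {y} {w} {a} a-letter (inj₂ (z , e)) with letterOrSplit z
  ... | inj₁ z-letter =
    inj₂ (inj₁ (cancelLastLetter a-letter z-letter e))
  ... | inj₂ (z' , b , b-letter , refl) =
    inj₂ (inj₂ (z' , cancelLastLetter a-letter b-letter (trans e (sym (assoc y z' b)))))

  SomePrefixIn : System → Word → Set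
  SomePrefixIn S x = Σ Word λ y → y ∈ S × Prefix y x

  MinimalPrefixIn : System → Word → Word → Set
  MinimalPrefixIn S x x₁ = x₁ ∈ S × Prefix x₁ x × (∀ y → y ∈ S → Prefix y x → Prefix x₁ y)

  HasMinimalPrefixes : Word → Set
  HasMinimalPrefixes x = ∀ S → SomePrefixIn S x → Σ Word (MinimalPrefixIn S x)

  prefixF : ∀ {n m} → Fin n → Fin n → Formula n m
  prefixF a b = (var b `≡ var a) `∨ `∃w (var (suc b) `≡ (var (suc a) `· var zero))

  -- The formula defining HasMinimalPrefixes (bound system variable 0 is S).
  hasMinimalPrefixesF : Formula 1 0
  hasMinimalPrefixesF =
    `∀S ((`∃w ((var zero `∈ zero) `∧ prefixF zero (suc zero))) `⇒
         `∃w ((var zero `∈ zero) `∧ (prefixF zero (suc zero) `∧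
              `∀w ((var zero `∈ zero) `⇒
                   (prefixF zero (suc (suc zero)) `⇒ prefixF (suc zero) zero)))))

  minimalPrefixesOfLetter : ∀ c → Letter c → HasMinimalPrefixes c
  minimalPrefixesOfLetter c c-letter S (y , y∈S , y≼c) with prefixOfLetter c-letter y≼c
  ... | refl = c , y∈S , inj₁ refl ,
        λ u _ u≼c → subst (λ v → Prefix v u) (prefixOfLetter c-letter u≼c) (inj₁ refl)

  -- If S contains a prefix of w, its least one is also least for w·a,
  -- because the only new prefix of w·a is w·a itself.
  minimalPrefixSnoc : ∀ {S w a x₁} → Letter a
    → MinimalPrefixIn S w x₁ → MinimalPrefixIn S (w · a) x₁
  minimalPrefixSnoc {S} {w} {a} {x₁} a-letter (x₁∈S , x₁≼w , least) =
    x₁∈S , prefixExtend a x₁≼w , leastSnoc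
    where
    leastSnoc : ∀ u → u ∈ S → Prefix u (w · a) → Prefix x₁ u
    leastSnoc u u∈S u≼wa with prefixOfSnoc a-letter u≼wa
    ... | inj₁ refl = prefixExtend a x₁≼w
    ... | inj₂ u≼w  = least u u∈S u≼w

  onlyPrefixSnoc : ∀ {S w a} → Letter a → (SomePrefixIn S w → ⊥)
    → ∀ {u} → u ∈ S → Prefix u (w · a) → u ≡ w · a
  onlyPrefixSnoc a-letter noPrefix {u} u∈S u≼wa with prefixOfSnoc a-letter u≼wa
  ... | inj₁ u≡wa = u≡wa
  ... | inj₂ u≼w  = ⊥-elim (noPrefix (u , u∈S , u≼w))

  minimalPrefixesOfSnoc : ExcludedMiddle 0ℓ → ∀ w a → Letter a
    → HasMinimalPrefixes w → HasMinimalPrefixes (w · a)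
  minimalPrefixesOfSnoc em w a a-letter ih S (y , y∈S , y≼wa) with em {SomePrefixIn S w}
  ... | yes somePrefix =
    let (x₁ , minimal) = ih S somePrefix in x₁ , minimalPrefixSnoc a-letter minimal
  ... | no noPrefix =
    w · a , subst (_∈ S) (only y∈S y≼wa) y∈S , inj₁ refl ,
    λ u u∈S u≼wa → subst (Prefix (w · a)) (sym (only u∈S u≼wa)) (inj₁ refl)
    where
    only : ∀ {u} → u ∈ S → Prefix u (w · a) → u ≡ w · a
    only = onlyPrefixSnoc a-letter noPrefix

  minimalPrefixes : ExcludedMiddle 0ℓ → ∀ x → HasMinimalPrefixes x
  minimalPrefixes em = definableInduction hasMinimalPrefixesF
    minimalPrefixesOfLetter (minimalPrefixesOfSnoc em)

mainTheorem15 : (M : Structure) → IsWordModel M → ExcludedMiddle 0ℓ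
    → (x : Structure.Word M) (S : Structure.System M) → Structure._∈_ M x S
    → Σ (Structure.Word M) λ x₁ → Structure._∈_ M x₁ S × IsPrefix M x₁ x
    × ((y : Structure.Word M) → Structure._∈_ M y S → IsPrefix M y x → IsPrefix M x₁ y)
mainTheorem15 M WM em x S x∈S =
  WordModel.minimalPrefixes M WM em x S (x , x∈S , inj₁ refl)
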